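{- Let $\mathcal C\subseteq\mathbb F_2^n$ be a binary linear code with parity check matrix $H$, minimum distance $d$ and error-correcting capacity $t=\left[\frac{d-1}{2}\right]$. Let $K$ be a field, let $<$ be a total-degree compatible term order on the monomials of $K[x_1,\dots,x_n]$ with $x_1<\dots<x_n$, and let $G_T$ be the reduced Gröbner basis of the ideal $I(\mathcal C)$ with respect to $<$. Let $w\in[X]$ be a monomial. If $\mathrm{weight}(\psi(\mathrm{Can}(w,G_T)))\le t$, then $\psi(\mathrm{Can}(w,G_T))$ is the error vector corresponding to $\psi(w)$, i.e. it is the (unique) vector $e$ of weight at most $t$ with $eH=\psi(w)H$. On the other hand, if $\mathrm{weight}(\psi(\mathrm{Can}(w,G_T)))> t$, then $\psi(w)$ contains more than $t$ errors, i.e. $\psi(w)\notin B(\mathcal C,t)$.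
   Context: A binary linear code $\mathcal C$ of length $n$ is an $\mathbb F_2$-subspace of $\mathbb F_2^n$; a parity check matrix $H$ is a matrix with $cH=0$ iff $c\in\mathcal C$. Weight is Hamming weight; $d$ is the minimum weight of a nonzero codeword; $[\cdot]$ is the integer part. $B(\mathcal C,t)=\{y\in\mathbb F_2^n:\exists c\in\mathcal C,\ d(c,y)\le t\}$; for $y\in B(\mathcal C,t)$ the equation $eH=yH$ has a unique solution $e$ of weight $\le t$, called the error vector of $y$. $[X]$ is the free commutative monoid on $X=\{x_1,\dots,x_n\}$ (the monomials of $K[x_1,\dots,x_n]$), and $\psi:[X]\to\mathbb F_2^n$ is the monoid morphism $\psi(\prod_i x_i^{\beta_i})=(\beta_1\bmod 2,\dots,\beta_n\bmod 2)$. The ideal associated with $\mathcal C$ is $I(\mathcal C)=\langle w-v : w,v\in[X],\ \psi(w)-\psi(v)\in\mathcal C\rangle\subseteq K[x_1,\dots,x_n]$; equivalently it is generated by $\{w_1-1,\dots,w_k-1\}\cup\{x_i^2-1: i=1,\dots,n\}$ where $w_1,\dots,w_k$ are monomials whose images under $\psi$ span $\mathcal C$. $\mathrm{Can}(w,G_T)$ denotes the canonical form (normal form) of $w$ modulo $G_T$. -}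

module Defs where

open import Level using (Level; _⊔_; suc)
open import Algebra.Bundles using (CommutativeRing)
open import Data.Bool using (Bool; true; false; _xor_; _∧_; if_then_else_)
open import Data.Nat as ℕ using (ℕ; zero) renaming (suc to 1+)
open import Data.Fin as Fin using (Fin)
open import Data.Vec.Properties using (≡-dec)
open import Data.Vec using (Vec; []; _∷_; replicate; zipWith; map; lookup; tabulate; foldr)
open import Data.List as List using (List)
open import Data.Maybe using (Maybe; just; nothing; maybe)
open import Data.Product using (Σ; ∃; _×_; _,_)
open import Data.Sum using (_⊎_)
open import Relation.Nullary using (¬_)
open import Relation.Binary.PropositionalEquality using (_≡_; _≢_)
open import Relation.Binary.Structures using (IsStrictTotalOrder)
open import Data.List.Membership.Propositional using (_∈_)
open import Induction.WellFounded using (WellFounded)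

record Field (c ℓ : Level) : Set (suc (c ⊔ ℓ)) where
  field
    commutativeRing : CommutativeRing c ℓ
  open CommutativeRing commutativeRing public
  field
    0≉1     : ¬ (0# ≈ 1#)
    inverse : ∀ x → ¬ (x ≈ 0#) → Σ Carrier λ y → (x * y) ≈ 1#

F2^ : ℕ → Set
F2^ n = Vec Bool n

_⊕_ : ∀ {n} → F2^ n → F2^ n → F2^ n
_⊕_ = zipWith _xor_

𝟎 : ∀ {n} → F2^ n
𝟎 = replicate _ false

weight : ∀ {n} → F2^ n → ℕ
weight []            = 0
weight (true  ∷ v)   = 1+ (weight v)
weight (false ∷ v)   = weight v

dist : ∀ {n} → F2^ n → F2^ n → ℕ
dist x y = weight (x ⊕ y)

-- A binary linear code: an F₂-subspace of F₂ⁿ, given as a predicate.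
-- (Over F₂ a subspace is a subset containing 0 and closed under +.)
record IsLinearCode {n : ℕ} (C : F2^ n → Set) : Set where
  field
    zero∈ : C 𝟎
    ⊕∈    : ∀ {x y} → C x → C y → C (x ⊕ y)

Mat : ℕ → ℕ → Set
Mat n r = Vec (Vec Bool r) n

_·_ : ∀ {n r} → F2^ n → Mat n r → F2^ r
[]      · []       = replicate _ false
(b ∷ y) · (h ∷ H)  = (if b then h else replicate _ false) ⊕ (y · H)

IsParityCheck : ∀ {n r} → (F2^ n → Set) → Mat n r → Set
IsParityCheck C H = ∀ c → (c · H ≡ 𝟎 → C c) × (C c → c · H ≡ 𝟎)

IsMinDistance : ∀ {n} → (F2^ n → Set) → ℕ → Set
IsMinDistance C d =
  (Σ _ λ c → C c × c ≢ 𝟎 × weight c ≡ d) ×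
  (∀ c → C c → c ≢ 𝟎 → d ℕ.≤ weight c)

capacity : ℕ → ℕ
capacity d = (d ℕ.∸ 1) ℕ./ 2

InBall : ∀ {n} → (F2^ n → Set) → ℕ → F2^ n → Set
InBall C t y = Σ _ λ c → C c × dist c y ℕ.≤ t

IsErrorVector : ∀ {n r} → (F2^ n → Set) → Mat n r → ℕ → F2^ n → F2^ n → Set
IsErrorVector C H t y e = InBall C t y × weight e ℕ.≤ t × e · H ≡ y · H

-- Monomials in x₁,…,xₙ : exponent vectors ([X] ≅ ℕⁿ)

Mono : ℕ → Set
Mono n = Vec ℕ n

one : ∀ {n} → Mono n
one = replicate _ 0

_·ₘ_ : ∀ {n} → Mono n → Mono n → Mono n
_·ₘ_ = zipWith ℕ._+_

var : ∀ {n} → Fin n → Mono n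
var i = tabulate λ j → if Fin.toℕ i ℕ.≡ᵇ Fin.toℕ j then 1 else 0

deg : ∀ {n} → Mono n → ℕ
deg = foldr _ ℕ._+_ 0

_∣ₘ_ : ∀ {n} → Mono n → Mono n → Set
u ∣ₘ m = Σ _ λ q → m ≡ q ·ₘ u

_/ₘ_ : ∀ {n} → Mono n → Mono n → Maybe (Mono n)
[]      /ₘ []      = just []
(a ∷ m) /ₘ (b ∷ u) with b ℕ.≤ᵇ a | m /ₘ u
... | true  | just q = just ((a ℕ.∸ b) ∷ q)
... | _     | _      = nothing

isOdd : ℕ → Bool
isOdd zero       = false
isOdd (1+ zero)  = true
isOdd (1+ (1+ k)) = isOdd k

ψ : ∀ {n} → Mono n → F2^ n
ψ = map isOdd

record IsTermOrder {n : ℕ} (_≺_ : Mono n → Mono n → Set) : Set₁ where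
  field
    strictTotal    : IsStrictTotalOrder _≡_ _≺_
    one-least      : ∀ m → m ≡ one ⊎ one ≺ m
    multiplicative : ∀ a b c → a ≺ b → (a ·ₘ c) ≺ (b ·ₘ c)

IsDegCompatible : ∀ {n} → (Mono n → Mono n → Set) → Set
IsDegCompatible _≺_ = ∀ a b → deg a ℕ.< deg b → a ≺ b

VarsIncreasing : ∀ {n} → (Mono n → Mono n → Set) → Set
VarsIncreasing _≺_ = ∀ i j → i Fin.< j → var i ≺ var j

module Polynomials {c ℓ} (K : Field c ℓ) (n : ℕ) where
  open Field K

  Coeffs : Set c
  Coeffs = Mono n → Carrier

  record Poly : Set (c ⊔ ℓ) where
    constructor poly
    field
      coeff   : Coeffs
      support : List (Mono n)
      finite  : ∀ m → ¬ (m ∈ support) → coeff m ≈ 0#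
  open Poly public

  monoC : Mono n → Coeffs
  monoC u m with ≡-dec ℕ._≟_ m u
  ... | Relation.Nullary.yes _ = 1#
  ... | Relation.Nullary.no  _ = 0#

  _-C_ : Coeffs → Coeffs → Coeffs
  (f -C g) m = f m - g m

  scaleShift : Carrier → Mono n → Coeffs → Coeffs
  scaleShift a u g m = maybe (λ q → a * g q) 0# (m /ₘ u)

  -- ideal generated by a (possibly infinite) set S of polynomials:
  -- h ∈ ⟨S⟩ iff h = Σⱼ aⱼ x^{uⱼ} gⱼ with gⱼ ∈ S (finite sum).
  Term : (Poly → Set (c ⊔ ℓ)) → Set (c ⊔ ℓ)
  Term S = Carrier × Mono n × Σ Poly S

  sumTerms : ∀ {S} → List (Term S) → Coeffs
  sumTerms List.[] m = 0#
  sumTerms ((a , u , g , _) List.∷ L) m = scaleShift a u (coeff g) m + sumTerms L m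

  InIdeal : (Poly → Set (c ⊔ ℓ)) → Coeffs → Set (c ⊔ ℓ)
  InIdeal S h = Σ (List (Term S)) λ L → ∀ m → h m ≈ sumTerms L m

  binomial : Mono n → Mono n → Poly
  binomial w v = poly (monoC w -C monoC v) (w List.∷ v List.∷ List.[]) fin
    where
    open import Data.List.Relation.Unary.Any using (here; there)
    fin : ∀ m → ¬ (m ∈ (w List.∷ v List.∷ List.[])) → (monoC w -C monoC v) m ≈ 0#
    fin m m∉ with ≡-dec ℕ._≟_ m w | ≡-dec ℕ._≟_ m v
    ... | Relation.Nullary.yes p | _ = Data.Empty.⊥-elim (m∉ (here p))
      where import Data.Empty
    ... | Relation.Nullary.no _ | Relation.Nullary.yes p = Data.Empty.⊥-elim (m∉ (there (here p)))
      where import Data.Empty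
    ... | Relation.Nullary.no _ | Relation.Nullary.no _ = -‿inverseʳ 0#

  CodeGens : (F2^ n → Set) → Poly → Set (c ⊔ ℓ)
  CodeGens C f = Σ (Mono n) λ w → Σ (Mono n) λ v →
                   C (ψ w ⊕ ψ v) × f ≡ binomial w v

  IdealOfCode : (F2^ n → Set) → Coeffs → Set (c ⊔ ℓ)
  IdealOfCode C = InIdeal (CodeGens C)

  NonZero : Coeffs → Set ℓ
  NonZero f = Σ (Mono n) λ m → ¬ (f m ≈ 0#)

  module _ (_≺_ : Mono n → Mono n → Set) where

    IsLM : Coeffs → Mono n → Set ℓ
    IsLM f m = ¬ (f m ≈ 0#) × (∀ m' → ¬ (f m' ≈ 0#) → m' ≡ m ⊎ m' ≺ m)

    record IsGroebnerBasis (I : Coeffs → Set (c ⊔ ℓ)) (G : List Poly) : Set (c ⊔ ℓ) where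
      field
        ⊆I      : ∀ i → I (coeff (List.lookup G i))
        nonzero : ∀ i → NonZero (coeff (List.lookup G i))
        lead    : ∀ f → I f → NonZero f → ∀ m → IsLM f m →
                  Σ _ λ i → Σ (Mono n) λ u → IsLM (coeff (List.lookup G i)) u × u ∣ₘ m

    record IsReducedGroebnerBasis (I : Coeffs → Set (c ⊔ ℓ)) (G : List Poly) : Set (c ⊔ ℓ) where
      field
        groebner : IsGroebnerBasis I G
        monic    : ∀ i u → IsLM (coeff (List.lookup G i)) u → coeff (List.lookup G i) u ≈ 1#
        reduced  : ∀ i j → i ≢ j → ∀ m → ¬ (coeff (List.lookup G i) m ≈ 0#) →
                   ∀ u → IsLM (coeff (List.lookup G j)) u → ¬ (u ∣ₘ m)

    IsCanonicalForm : List Poly → Coeffs → Coeffs → Set (c ⊔ ℓ)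
    IsCanonicalForm G f r =
      InIdeal (λ g → Σ _ λ i → List.lookup G i ≡ g) (f -C r) ×
      (∀ m → ¬ (r m ≈ 0#) → ∀ i u → IsLM (coeff (List.lookup G i)) u → ¬ (u ∣ₘ m))

module Submission where

-- Every element of I(C) is a K-linear combination of shifted generators x^p - x^q
-- with ψ(p)H = ψ(q)H. Summing coefficients over one syndrome class kills each of
-- them, so x^w - x^u ∈ I(C), where x^u = Can(x^w, G), forces ψ(u)H = ψ(w)H: this is
-- the first claim. If moreover ψ(w) were within distance t of the code, its coset
-- would contain some e of weight ≤ t < weight(ψ(u)) ≤ deg(u). Then x^u - x^e ∈ I(C)
-- has leading monomial x^u since the order refines degree, so x^u would be divisible
-- by a leading monomial of G, contradicting that it is a canonical form.

open import Defs
open import Level using (Level; _⊔_)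
open import Data.Bool using (Bool; true; false; not; _xor_; if_then_else_)
open import Data.Bool.Properties
  using (xor-assoc; xor-comm; xor-identityˡ; xor-identityʳ; xor-same; not-distribˡ-xor; T-≡)
open import Data.Nat as ℕ using (ℕ; zero; suc; _≤_; _<_; _>_; _≤ᵇ_; z≤n; s≤s)
open import Data.Nat.Properties as ℕ
  using (≤ᵇ⇒≤; ≤⇒≤ᵇ; m∸n+n≡m; m+n∸n≡m; m≤n+m; +-cancelʳ-≡; +-mono-≤; ≤-trans; <-irrefl)
open import Data.Vec as Vec using ([]; _∷_)
open import Data.Vec.Properties using (≡-dec; zipWith-assoc; zipWith-comm; zipWith-identityˡ; zipWith-identityʳ)
open import Data.Maybe using (just; nothing)
open import Data.Product using (Σ; ∃; _×_; _,_; proj₁; proj₂)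
open import Data.Sum using (_⊎_; inj₁; inj₂)
open import Function using (_∘_; case_of_; Equivalence; _⇔_; mk⇔)
open import Data.List as List using (List; []; _∷_; _++_; filter; deduplicate)
open import Data.List.Membership.Propositional.Properties using (∈-filter⁺; ∈-filter⁻; ∈-deduplicate⁺)
open import Data.List.Relation.Unary.Unique.Propositional.Properties using (filter⁺)
open import Data.List.Relation.Unary.Any using (here; there)
import Data.List.Relation.Unary.All as All
open import Data.List.Relation.Unary.AllPairs using (_∷_)
open import Data.List.Relation.Unary.Unique.Propositional using (Unique)
open import Data.List.Membership.Propositional using (_∈_; _∉_)
open import Data.Empty using (⊥-elim)
open import Relation.Nullary using (¬_; Dec; yes; no)
open import Relation.Binary.Definitions using (DecidableEquality)
open import Relation.Binary.PropositionalEquality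
  using (_≡_; _≢_; refl; sym; trans; cong; cong₂; subst; module ≡-Reasoning)

⊕-assoc : ∀ {n} (x y z : F2^ n) → (x ⊕ y) ⊕ z ≡ x ⊕ (y ⊕ z)
⊕-assoc = zipWith-assoc xor-assoc

⊕-comm : ∀ {n} (x y : F2^ n) → x ⊕ y ≡ y ⊕ x
⊕-comm = zipWith-comm xor-comm

⊕-identityˡ : ∀ {n} (x : F2^ n) → 𝟎 ⊕ x ≡ x
⊕-identityˡ = zipWith-identityˡ xor-identityˡ

⊕-identityʳ : ∀ {n} (x : F2^ n) → x ⊕ 𝟎 ≡ x
⊕-identityʳ = zipWith-identityʳ xor-identityʳ

⊕-self : ∀ {n} (x : F2^ n) → x ⊕ x ≡ 𝟎
⊕-self []      = refl
⊕-self (b ∷ x) = cong₂ _∷_ (xor-same b) (⊕-self x)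

⊕-cancelʳ : ∀ {n} (x y : F2^ n) → (x ⊕ y) ⊕ y ≡ x
⊕-cancelʳ x y = begin
  (x ⊕ y) ⊕ y  ≡⟨ ⊕-assoc x y y ⟩
  x ⊕ (y ⊕ y)  ≡⟨ cong (x ⊕_) (⊕-self y) ⟩
  x ⊕ 𝟎        ≡⟨ ⊕-identityʳ x ⟩
  x            ∎
  where open ≡-Reasoning

⊕≡𝟎⇒≡ : ∀ {n} {x y : F2^ n} → x ⊕ y ≡ 𝟎 → x ≡ y
⊕≡𝟎⇒≡ {x = x} {y} x⊕y≡𝟎 = begin
  x            ≡⟨ sym (⊕-cancelʳ x y) ⟩
  (x ⊕ y) ⊕ y  ≡⟨ cong (_⊕ y) x⊕y≡𝟎 ⟩
  𝟎 ⊕ y        ≡⟨ ⊕-identityˡ y ⟩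
  y            ∎
  where open ≡-Reasoning

⊕-interchange : ∀ {n} (a b c d : F2^ n) → (a ⊕ b) ⊕ (c ⊕ d) ≡ (a ⊕ c) ⊕ (b ⊕ d)
⊕-interchange a b c d = begin
  (a ⊕ b) ⊕ (c ⊕ d)  ≡⟨ ⊕-assoc a b (c ⊕ d) ⟩
  a ⊕ (b ⊕ (c ⊕ d))  ≡⟨ cong (a ⊕_) (sym (⊕-assoc b c d)) ⟩
  a ⊕ ((b ⊕ c) ⊕ d)  ≡⟨ cong (λ z → a ⊕ (z ⊕ d)) (⊕-comm b c) ⟩
  a ⊕ ((c ⊕ b) ⊕ d)  ≡⟨ cong (a ⊕_) (⊕-assoc c b d) ⟩
  a ⊕ (c ⊕ (b ⊕ d))  ≡⟨ sym (⊕-assoc a c (b ⊕ d)) ⟩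
  (a ⊕ c) ⊕ (b ⊕ d)  ∎
  where open ≡-Reasoning

if-xor-⊕ : ∀ {r} (a b : Bool) (h : F2^ r) →
  (if a xor b then h else 𝟎) ≡ (if a then h else 𝟎) ⊕ (if b then h else 𝟎)
if-xor-⊕ true  true  h = sym (⊕-self h)
if-xor-⊕ true  false h = sym (⊕-identityʳ h)
if-xor-⊕ false true  h = sym (⊕-identityˡ h)
if-xor-⊕ false false h = sym (⊕-identityˡ 𝟎)

·-distribʳ-⊕ : ∀ {n r} (x y : F2^ n) (H : Mat n r) → (x ⊕ y) · H ≡ (x · H) ⊕ (y · H)
·-distribʳ-⊕ []      []      []      = sym (⊕-identityˡ 𝟎)
·-distribʳ-⊕ (a ∷ x) (b ∷ y) (h ∷ H) = begin
  (if a xor b then h else 𝟎) ⊕ ((x ⊕ y) · H)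
    ≡⟨ cong₂ _⊕_ (if-xor-⊕ a b h) (·-distribʳ-⊕ x y H) ⟩
  ((if a then h else 𝟎) ⊕ (if b then h else 𝟎)) ⊕ ((x · H) ⊕ (y · H))
    ≡⟨ ⊕-interchange _ _ _ _ ⟩
  ((if a then h else 𝟎) ⊕ (x · H)) ⊕ ((if b then h else 𝟎) ⊕ (y · H))  ∎
  where open ≡-Reasoning

module _ {n r} {C : F2^ n → Set} {H : Mat n r} (parity : IsParityCheck C H) where

  sameSyndrome⇒∈C : ∀ {x y} → x · H ≡ y · H → C (x ⊕ y)
  sameSyndrome⇒∈C {x} {y} xH≡yH = proj₁ (parity (x ⊕ y)) (begin
    (x ⊕ y) · H        ≡⟨ ·-distribʳ-⊕ x y H ⟩
    (x · H) ⊕ (y · H)  ≡⟨ cong (_⊕ (y · H)) xH≡yH ⟩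
    (y · H) ⊕ (y · H)  ≡⟨ ⊕-self (y · H) ⟩
    𝟎                  ∎)
    where open ≡-Reasoning

  ∈C⇒sameSyndrome : ∀ {x y} → C (x ⊕ y) → x · H ≡ y · H
  ∈C⇒sameSyndrome {x} {y} x⊕y∈C =
    ⊕≡𝟎⇒≡ (trans (sym (·-distribʳ-⊕ x y H)) (proj₂ (parity (x ⊕ y)) x⊕y∈C))

  sameSyndrome⇒IsErrorVector : ∀ {t y e} → e · H ≡ y · H → weight e ≤ t →
                               IsErrorVector C H t y e
  sameSyndrome⇒IsErrorVector {t} {y} {e} eH≡yH wt≤t =
    (e ⊕ y , sameSyndrome⇒∈C eH≡yH , subst (λ z → weight z ≤ t) (sym (⊕-cancelʳ e y)) wt≤t)
    , wt≤t , eH≡yH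

  InBall⇒lightSameSyndrome : ∀ {t y} → InBall C t y → ∃ λ e → weight e ≤ t × e · H ≡ y · H
  InBall⇒lightSameSyndrome {y = y} (c , c∈C , dist≤t) = c ⊕ y , dist≤t , (begin
    (c ⊕ y) · H        ≡⟨ ·-distribʳ-⊕ c y H ⟩
    (c · H) ⊕ (y · H)  ≡⟨ cong (_⊕ (y · H)) (proj₂ (parity c) c∈C) ⟩
    𝟎 ⊕ (y · H)        ≡⟨ ⊕-identityˡ (y · H) ⟩
    y · H              ∎)
    where open ≡-Reasoning

isOdd-suc : ∀ k → isOdd (suc k) ≡ not (isOdd k)
isOdd-suc zero          = refl
isOdd-suc (suc zero)    = refl
isOdd-suc (suc (suc k)) = isOdd-suc k

isOdd-+ : ∀ a b → isOdd (a ℕ.+ b) ≡ isOdd a xor isOdd b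
isOdd-+ zero    b = refl
isOdd-+ (suc a) b = begin
  isOdd (suc (a ℕ.+ b))      ≡⟨ isOdd-suc (a ℕ.+ b) ⟩
  not (isOdd (a ℕ.+ b))      ≡⟨ cong not (isOdd-+ a b) ⟩
  not (isOdd a xor isOdd b)  ≡⟨ not-distribˡ-xor (isOdd a) (isOdd b) ⟩
  not (isOdd a) xor isOdd b  ≡⟨ cong (_xor isOdd b) (sym (isOdd-suc a)) ⟩
  isOdd (suc a) xor isOdd b  ∎
  where open ≡-Reasoning

ψ-·ₘ : ∀ {n} (p q : Mono n) → ψ (p ·ₘ q) ≡ ψ p ⊕ ψ q
ψ-·ₘ []      []      = refl
ψ-·ₘ (a ∷ p) (b ∷ q) = cong₂ _∷_ (isOdd-+ a b) (ψ-·ₘ p q)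

syndromeₘ : ∀ {n r} → Mat n r → Mono n → F2^ r
syndromeₘ H m = ψ m · H

syndromeₘ-·ₘ : ∀ {n r} (H : Mat n r) p q v → syndromeₘ H p ≡ syndromeₘ H q →
               syndromeₘ H (p ·ₘ v) ≡ syndromeₘ H (q ·ₘ v)
syndromeₘ-·ₘ H p q v pH≡qH = begin
  ψ (p ·ₘ v) · H           ≡⟨ cong (_· H) (ψ-·ₘ p v) ⟩
  (ψ p ⊕ ψ v) · H          ≡⟨ ·-distribʳ-⊕ (ψ p) (ψ v) H ⟩
  (ψ p · H) ⊕ (ψ v · H)    ≡⟨ cong (_⊕ (ψ v · H)) pH≡qH ⟩
  (ψ q · H) ⊕ (ψ v · H)    ≡⟨ ·-distribʳ-⊕ (ψ q) (ψ v) H ⟨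
  (ψ q ⊕ ψ v) · H          ≡⟨ cong (_· H) (ψ-·ₘ q v) ⟨
  ψ (q ·ₘ v) · H           ∎
  where open ≡-Reasoning

·ₘ-cancelʳ : ∀ {n} (p q v : Mono n) → p ·ₘ v ≡ q ·ₘ v → p ≡ q
·ₘ-cancelʳ []      []      []      _  = refl
·ₘ-cancelʳ (a ∷ p) (b ∷ q) (c ∷ v) eq =
  cong₂ _∷_ (+-cancelʳ-≡ c a b (cong Vec.head eq)) (·ₘ-cancelʳ p q v (cong Vec.tail eq))

/ₘ-sound : ∀ {n} (m v q : Mono n) → m /ₘ v ≡ just q → m ≡ q ·ₘ v
/ₘ-sound []      []      []      _ = refl
/ₘ-sound (a ∷ m) (b ∷ v) q eq with b ≤ᵇ a in b≤ᵇa | m /ₘ v in m/v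
/ₘ-sound (a ∷ m) (b ∷ v) _ refl | true | just q′ =
  cong₂ _∷_ (sym (m∸n+n≡m (≤ᵇ⇒≤ b a (Equivalence.from T-≡ b≤ᵇa)))) (/ₘ-sound m v q′ m/v)

·ₘ-/ₘ : ∀ {n} (q v : Mono n) → (q ·ₘ v) /ₘ v ≡ just q
·ₘ-/ₘ []      []      = refl
·ₘ-/ₘ (a ∷ q) (b ∷ v)
  rewrite Equivalence.to T-≡ (≤⇒≤ᵇ (m≤n+m b a)) | ·ₘ-/ₘ q v | m+n∸n≡m a b = refl

/ₘ-one : ∀ {n} (m : Mono n) → m /ₘ one ≡ just m
/ₘ-one []      = refl
/ₘ-one (a ∷ m) rewrite /ₘ-one m = refl

squarefree : ∀ {n} → F2^ n → Mono n
squarefree = Vec.map (λ b → if b then 1 else 0)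

ψ-squarefree : ∀ {n} (e : F2^ n) → ψ (squarefree e) ≡ e
ψ-squarefree []          = refl
ψ-squarefree (true ∷ e)  = cong (true ∷_) (ψ-squarefree e)
ψ-squarefree (false ∷ e) = cong (false ∷_) (ψ-squarefree e)

deg-squarefree : ∀ {n} (e : F2^ n) → deg (squarefree e) ≡ weight e
deg-squarefree []          = refl
deg-squarefree (true ∷ e)  = cong suc (deg-squarefree e)
deg-squarefree (false ∷ e) = deg-squarefree e

isOdd⇒1≤ : ∀ {a} → isOdd a ≡ true → 1 ≤ a
isOdd⇒1≤ {suc a} _ = s≤s z≤n

weight-ψ≤deg : ∀ {n} (u : Mono n) → weight (ψ u) ≤ deg u
weight-ψ≤deg []      = z≤n
weight-ψ≤deg (a ∷ u) with isOdd a in odd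
... | true  = +-mono-≤ (isOdd⇒1≤ odd) (weight-ψ≤deg u)
... | false = ≤-trans (weight-ψ≤deg u) (m≤n+m (deg u) a)

module _ {c ℓ} (K : Field c ℓ) {n : ℕ} where
  open Field K renaming (refl to ≈-refl; sym to ≈-sym; trans to ≈-trans; reflexive to ≈-reflexive)
  open Polynomials K n
  open import Relation.Binary.Reasoning.Setoid setoid
  open import Algebra.Properties.Ring ring using (-0#≈0#)
  open import Algebra.Properties.AbelianGroup +-abelianGroup using (⁻¹-∙-comm)
  open import Algebra.Properties.CommutativeSemigroup +-commutativeSemigroup using (interchange)
  open import Data.List.Membership.DecPropositional (≡-dec {n = n} ℕ._≟_) using (_∈?_)
  open import Data.List.Relation.Unary.Unique.DecPropositional.Properties (≡-dec {n = n} ℕ._≟_)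
    using (deduplicate-!)

  1#-0#≈1# : 1# - 0# ≈ 1#
  1#-0#≈1# = ≈-trans (+-congˡ -0#≈0#) (+-identityʳ 1#)

  monoC-self : ∀ u → monoC u u ≡ 1#
  monoC-self u with ≡-dec ℕ._≟_ u u
  ... | yes _   = refl
  ... | no u≢u = ⊥-elim (u≢u refl)

  monoC-≢ : ∀ u {m} → m ≢ u → monoC u m ≡ 0#
  monoC-≢ u {m} m≢u with ≡-dec ℕ._≟_ m u
  ... | yes m≡u = ⊥-elim (m≢u m≡u)
  ... | no _    = refl

  monoC-·ₘ : ∀ p q v → monoC (p ·ₘ v) (q ·ₘ v) ≡ monoC p q
  monoC-·ₘ p q v with ≡-dec ℕ._≟_ q p
  ... | yes refl = monoC-self (p ·ₘ v)
  ... | no q≢p   = monoC-≢ (p ·ₘ v) (q≢p ∘ ·ₘ-cancelʳ q p v)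

  sumOver : List (Mono n) → Coeffs → Carrier
  sumOver []      f = 0#
  sumOver (m ∷ M) f = f m + sumOver M f

  sumOver-cong : ∀ M {f g} → (∀ m → f m ≈ g m) → sumOver M f ≈ sumOver M g
  sumOver-cong []      f≈g = ≈-refl
  sumOver-cong (m ∷ M) f≈g = +-cong (f≈g m) (sumOver-cong M f≈g)

  sumOver-zero : ∀ M → sumOver M (λ _ → 0#) ≈ 0#
  sumOver-zero []      = ≈-refl
  sumOver-zero (m ∷ M) = ≈-trans (+-identityˡ _) (sumOver-zero M)

  sumOver-+ : ∀ M f g → sumOver M (λ m → f m + g m) ≈ sumOver M f + sumOver M g
  sumOver-+ []      f g = ≈-sym (+-identityʳ 0#)
  sumOver-+ (m ∷ M) f g = ≈-trans (+-congˡ (sumOver-+ M f g)) (interchange _ _ _ _)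

  sumOver-* : ∀ M a f → sumOver M (λ m → a * f m) ≈ a * sumOver M f
  sumOver-* []      a f = ≈-sym (zeroʳ a)
  sumOver-* (m ∷ M) a f = ≈-trans (+-congˡ (sumOver-* M a f)) (≈-sym (distribˡ a _ _))

  sumOver-neg : ∀ M f → sumOver M (λ m → - f m) ≈ - sumOver M f
  sumOver-neg []      f = ≈-sym -0#≈0#
  sumOver-neg (m ∷ M) f = ≈-trans (+-congˡ (sumOver-neg M f)) (⁻¹-∙-comm _ _)

  sumOver-sub : ∀ M f g → sumOver M (f -C g) ≈ sumOver M f - sumOver M g
  sumOver-sub M f g = ≈-trans (sumOver-+ M f (λ m → - g m)) (+-congˡ (sumOver-neg M g))

  sumOver-monoC-∉ : ∀ {M p} → p ∉ M → sumOver M (monoC p) ≈ 0#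
  sumOver-monoC-∉ {[]}    p∉M = ≈-refl
  sumOver-monoC-∉ {m ∷ M} {p} p∉M = ≈-trans
    (+-cong (≈-reflexive (monoC-≢ p (p∉M ∘ here ∘ sym))) (sumOver-monoC-∉ (p∉M ∘ there)))
    (+-identityˡ 0#)

  sumOver-monoC-∈ : ∀ {M p} → Unique M → p ∈ M → sumOver M (monoC p) ≈ 1#
  sumOver-monoC-∈ {m ∷ M} (m∉M ∷ _) (here refl) = ≈-trans
    (+-cong (≈-reflexive (monoC-self m)) (sumOver-monoC-∉ λ p∈M → All.lookup m∉M p∈M refl))
    (+-identityʳ 1#)
  sumOver-monoC-∈ {p = p} (m∉M ∷ unique) (there p∈M) = ≈-trans
    (+-cong (≈-reflexive (monoC-≢ p (All.lookup m∉M p∈M))) (sumOver-monoC-∈ unique p∈M))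
    (+-identityˡ 1#)

  sumOver-monoC-cong : ∀ {M p q} → Unique M → p ∈ M ⇔ q ∈ M →
                       sumOver M (monoC p) ≈ sumOver M (monoC q)
  sumOver-monoC-cong {M} {p} unique p∈⇔q∈ with p ∈? M
  ... | yes p∈M = ≈-trans (sumOver-monoC-∈ unique p∈M)
                          (≈-sym (sumOver-monoC-∈ unique (Equivalence.to p∈⇔q∈ p∈M)))
  ... | no  p∉M = ≈-trans (sumOver-monoC-∉ p∉M)
                          (≈-sym (sumOver-monoC-∉ (p∉M ∘ Equivalence.from p∈⇔q∈)))

  module _ {s} {A : Set s} (σ : Mono n → A) where

    record BalancedBinomial : Set (s ⊔ c) where
      constructor balanced
      field
        coefficient : Carrier
        left right  : Mono n
        σ-equal     : σ left ≡ σ right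

      value : Coeffs
      value m = coefficient * (monoC left m - monoC right m)
    open BalancedBinomial

    combination : List BalancedBinomial → Coeffs
    combination []      m = 0#
    combination (b ∷ T) m = value b m + combination T m

    Balanced : Coeffs → Set (s ⊔ c ⊔ ℓ)
    Balanced h = Σ (List BalancedBinomial) λ T → ∀ m → h m ≈ combination T m

    combination-++ : ∀ T U m → combination (T ++ U) m ≈ combination T m + combination U m
    combination-++ []      U m = ≈-sym (+-identityˡ _)
    combination-++ (b ∷ T) U m = ≈-trans (+-congˡ (combination-++ T U m)) (≈-sym (+-assoc _ _ _))

    Balanced-resp : ∀ {f g} → (∀ m → f m ≈ g m) → Balanced g → Balanced f
    Balanced-resp f≈g (T , g≈T) = T , λ m → ≈-trans (f≈g m) (g≈T m)

    Balanced-+ : ∀ {f g} → Balanced f → Balanced g → Balanced (λ m → f m + g m)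
    Balanced-+ (T , f≈T) (U , g≈U) =
      T ++ U , λ m → ≈-trans (+-cong (f≈T m) (g≈U m)) (≈-sym (combination-++ T U m))

    module _ (σ-·ₘ : ∀ p q v → σ p ≡ σ q → σ (p ·ₘ v) ≡ σ (q ·ₘ v)) where

      scaleShiftBinomial : Carrier → Mono n → BalancedBinomial → BalancedBinomial
      scaleShiftBinomial a v (balanced b p q σp≡σq) =
        balanced (a * b) (p ·ₘ v) (q ·ₘ v) (σ-·ₘ p q v σp≡σq)

      scaleShift-value : ∀ a v b m →
                         scaleShift a v (value b) m ≈ value (scaleShiftBinomial a v b) m
      scaleShift-value a v (balanced b p q _) m with m /ₘ v in m/v
      ... | just m′ rewrite /ₘ-sound m v m′ m/v | monoC-·ₘ p m′ v | monoC-·ₘ q m′ v =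
        ≈-sym (*-assoc a b _)
      ... | nothing = begin
        0#                                                 ≈⟨ ≈-sym (zeroʳ (a * b)) ⟩
        (a * b) * 0#                                       ≈⟨ *-congˡ (≈-sym (-‿inverseʳ 0#)) ⟩
        (a * b) * (0# - 0#)                                ≡⟨ cong₂ (λ x y → (a * b) * (x - y))
                                                                    (sym (monoC-∤ p)) (sym (monoC-∤ q)) ⟩
        (a * b) * (monoC (p ·ₘ v) m - monoC (q ·ₘ v) m)    ∎
        where
        monoC-∤ : ∀ p → monoC (p ·ₘ v) m ≡ 0#
        monoC-∤ p = monoC-≢ (p ·ₘ v) {m} λ { refl → case trans (sym m/v) (·ₘ-/ₘ p v) of λ () }

      scaleShift-+ : ∀ a v f g m →
                     scaleShift a v (λ m → f m + g m) m ≈ scaleShift a v f m + scaleShift a v g m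
      scaleShift-+ a v f g m with m /ₘ v
      ... | just m′ = distribˡ a (f m′) (g m′)
      ... | nothing = ≈-sym (+-identityʳ 0#)

      scaleShift-cong : ∀ a v {f g} → (∀ m → f m ≈ g m) → ∀ m → scaleShift a v f m ≈ scaleShift a v g m
      scaleShift-cong a v f≈g m with m /ₘ v
      ... | just m′ = *-congˡ (f≈g m′)
      ... | nothing = ≈-refl

      scaleShift-combination : ∀ a v T m →
        scaleShift a v (combination T) m ≈ combination (List.map (scaleShiftBinomial a v) T) m
      scaleShift-combination a v []      m with m /ₘ v
      ... | just _  = zeroʳ a
      ... | nothing = ≈-refl
      scaleShift-combination a v (b ∷ T) m = ≈-trans
        (scaleShift-+ a v (value b) (combination T) m)
        (+-cong (scaleShift-value a v b m) (scaleShift-combination a v T m))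

      scaleShift-Balanced : ∀ a v {h} → Balanced h → Balanced (scaleShift a v h)
      scaleShift-Balanced a v (T , h≈T) = List.map (scaleShiftBinomial a v) T ,
        λ m → ≈-trans (scaleShift-cong a v h≈T m) (scaleShift-combination a v T m)

      InIdeal-Balanced : ∀ {S} → (∀ g → S g → Balanced (coeff g)) → ∀ {h} → InIdeal S h → Balanced h
      InIdeal-Balanced {S} S-Balanced (terms , h≈) = Balanced-resp h≈ (sumTerms-Balanced terms)
        where
        sumTerms-Balanced : (terms : List (Term S)) → Balanced (sumTerms terms)
        sumTerms-Balanced []                        = [] , λ _ → ≈-refl
        sumTerms-Balanced ((a , v , g , g∈S) ∷ terms) =
          Balanced-+ (scaleShift-Balanced a v (S-Balanced g g∈S)) (sumTerms-Balanced terms)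

    points : List BalancedBinomial → List (Mono n)
    points []      = []
    points (b ∷ T) = left b ∷ right b ∷ points T

    left∈points : ∀ {b T} → b ∈ T → left b ∈ points T
    left∈points (here refl)  = here refl
    left∈points (there b∈T) = there (there (left∈points b∈T))

    right∈points : ∀ {b T} → b ∈ T → right b ∈ points T
    right∈points (here refl)  = there (here refl)
    right∈points (there b∈T) = there (there (right∈points b∈T))

    sumOver-combination : ∀ {M} T → Unique M → (∀ {b} → b ∈ T → left b ∈ M ⇔ right b ∈ M) →
                          sumOver M (combination T) ≈ 0#
    sumOver-combination {M} []      _      _      = sumOver-zero M
    sumOver-combination {M} (b@(balanced a p q _) ∷ T) unique closed = begin
      sumOver M (λ m → value b m + combination T m)
        ≈⟨ sumOver-+ M (value b) (combination T) ⟩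
      sumOver M (value b) + sumOver M (combination T)
        ≈⟨ +-cong sumOver-value (sumOver-combination T unique (closed ∘ there)) ⟩
      0# + 0#
        ≈⟨ +-identityʳ 0# ⟩
      0# ∎
      where
      sumOver-value : sumOver M (value b) ≈ 0#
      sumOver-value = begin
        sumOver M (value b)                          ≈⟨ sumOver-* M a (monoC p -C monoC q) ⟩
        a * sumOver M (monoC p -C monoC q)           ≈⟨ *-congˡ (sumOver-sub M (monoC p) (monoC q)) ⟩
        a * (sumOver M (monoC p) - sumOver M (monoC q))
          ≈⟨ *-congˡ (+-congˡ (-‿cong (sumOver-monoC-cong unique (closed (here refl))))) ⟨
        a * (sumOver M (monoC p) - sumOver M (monoC p)) ≈⟨ *-congˡ (-‿inverseʳ _) ⟩
        a * 0#                                       ≈⟨ zeroʳ a ⟩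
        0#                                           ∎

    module _ (_≟σ_ : DecidableEquality A) where

      -- The functional "sum of the coefficients over the σ-class of w" kills every
      -- balanced binomial, but takes the value 1 - [σ u ≡ σ w] on x^w - x^u.
      Balanced-binomial⇒σ≡ : ∀ w u → Balanced (monoC w -C monoC u) → σ u ≡ σ w
      Balanced-binomial⇒σ≡ w u (T , w-u≈T) with σ u ≟σ σ w
      ... | yes σu≡σw = σu≡σw
      ... | no  σu≢σw = ⊥-elim (0≉1 (begin
        0#                                                   ≈⟨ sumOver-combination T unique closed ⟨
        sumOver class (combination T)                        ≈⟨ sumOver-cong class w-u≈T ⟨
        sumOver class (monoC w -C monoC u)                   ≈⟨ sumOver-sub class (monoC w) (monoC u) ⟩
        sumOver class (monoC w) - sumOver class (monoC u)    ≈⟨ +-cong w-mass (-‿cong u-mass) ⟩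
        1# - 0#                                              ≈⟨ 1#-0#≈1# ⟩
        1#                                                   ∎))
        where
        candidates : List (Mono n)
        candidates = w ∷ u ∷ points T

        inClass? : ∀ m → Dec (σ m ≡ σ w)
        inClass? m = σ m ≟σ σ w

        class : List (Mono n)
        class = filter inClass? (deduplicate (≡-dec ℕ._≟_) candidates)

        unique : Unique class
        unique = filter⁺ inClass? (deduplicate-! candidates)

        ∈class : ∀ {m} → m ∈ candidates → σ m ≡ σ w → m ∈ class
        ∈class m∈ σm≡σw = ∈-filter⁺ inClass? (∈-deduplicate⁺ (≡-dec ℕ._≟_) m∈) σm≡σw

        class-σ : ∀ {m} → m ∈ class → σ m ≡ σ w
        class-σ = proj₂ ∘ ∈-filter⁻ inClass?

        closed : ∀ {b} → b ∈ T → left b ∈ class ⇔ right b ∈ class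
        closed {b} b∈T = mk⇔
          (λ l∈ → ∈class (there (there (right∈points b∈T))) (trans (sym (σ-equal b)) (class-σ l∈)))
          (λ r∈ → ∈class (there (there (left∈points b∈T))) (trans (σ-equal b) (class-σ r∈)))

        w-mass : sumOver class (monoC w) ≈ 1#
        w-mass = sumOver-monoC-∈ unique (∈class (here refl) refl)

        u-mass : sumOver class (monoC u) ≈ 0#
        u-mass = sumOver-monoC-∉ (σu≢σw ∘ class-σ)

  module _ (_≺_ : Mono n → Mono n → Set) where

    binomial-IsLM : ∀ {u v} → v ≺ u → v ≢ u → IsLM _≺_ (monoC u -C monoC v) u
    binomial-IsLM {u} {v} v≺u v≢u = leading≉0 , dominated
      where
      leading≉0 : ¬ ((monoC u -C monoC v) u ≈ 0#)
      leading≉0 eq = 0≉1 (begin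
        0#                      ≈⟨ eq ⟨
        monoC u u - monoC v u   ≡⟨ cong₂ _-_ (monoC-self u) (monoC-≢ v (v≢u ∘ sym)) ⟩
        1# - 0#                 ≈⟨ 1#-0#≈1# ⟩
        1#                      ∎)

      dominated : ∀ m → ¬ ((monoC u -C monoC v) m ≈ 0#) → m ≡ u ⊎ m ≺ u
      dominated m m≉0 with ≡-dec ℕ._≟_ m u | ≡-dec ℕ._≟_ m v
      ... | yes m≡u | _        = inj₁ m≡u
      ... | no _    | yes refl = inj₂ v≺u
      -- here the `with` has already reduced both coefficients of m to 0#
      ... | no _    | no _     = ⊥-elim (m≉0 (-‿inverseʳ 0#))

    canonicalMonomial-notLeading : ∀ {I G f u h} → IsGroebnerBasis _≺_ I G →
      IsCanonicalForm _≺_ G f (monoC u) → I h → ¬ IsLM _≺_ h u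
    canonicalMonomial-notLeading {u = u} {h} groebner (_ , irreducible) h∈I lm
      with IsGroebnerBasis.lead groebner h h∈I (u , proj₁ lm) u lm
    ... | i , u′ , lmᵢ , u′∣u = irreducible u u-coeff≉0 i u′ lmᵢ u′∣u
      where
      u-coeff≉0 : ¬ (monoC u u ≈ 0#)
      u-coeff≉0 eq = 0≉1 (≈-trans (≈-sym eq) (≈-reflexive (monoC-self u)))

module _ {c ℓ} (K : Field c ℓ) {n r} {C : F2^ n → Set} {H : Mat n r} (parity : IsParityCheck C H) where
  open Field K renaming (refl to ≈-refl; sym to ≈-sym; trans to ≈-trans)
  open Polynomials K n

  IdealOfCode-Balanced : ∀ {h} → IdealOfCode C h → Balanced K (syndromeₘ H) h
  IdealOfCode-Balanced = InIdeal-Balanced K (syndromeₘ H) (syndromeₘ-·ₘ H) generator-Balanced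
    where
    generator-Balanced : ∀ g → CodeGens C g → Balanced K (syndromeₘ H) (coeff g)
    generator-Balanced _ (w , v , w+v∈C , refl) =
      balanced 1# w v (∈C⇒sameSyndrome parity w+v∈C) ∷ [] ,
      λ m → ≈-sym (≈-trans (+-identityʳ _) (*-identityˡ _))

  canonicalForm-sameSyndrome : ∀ {_≺_ G w u} → IsGroebnerBasis _≺_ (IdealOfCode C) G →
    IsCanonicalForm _≺_ G (monoC w) (monoC u) → ψ u · H ≡ ψ w · H
  canonicalForm-sameSyndrome {G = G} {w} {u} groebner (w-u∈⟨G⟩ , _) =
    Balanced-binomial⇒σ≡ K (syndromeₘ H) (≡-dec Data.Bool._≟_) w u
      (InIdeal-Balanced K (syndromeₘ H) (syndromeₘ-·ₘ H) G-Balanced w-u∈⟨G⟩)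
    where
    G-Balanced : ∀ g → (Σ _ λ i → List.lookup G i ≡ g) → Balanced K (syndromeₘ H) (coeff g)
    G-Balanced _ (i , refl) = IdealOfCode-Balanced (IsGroebnerBasis.⊆I groebner i)

  binomial∈IdealOfCode : ∀ {u v} → C (ψ u ⊕ ψ v) → IdealOfCode C (monoC u -C monoC v)
  binomial∈IdealOfCode {u} {v} u+v∈C = generator ∷ [] , unit-multiple
    where
    generator : Term (CodeGens C)
    generator = 1# , one , binomial u v , u , v , u+v∈C , refl

    unit-multiple : ∀ m → (monoC u -C monoC v) m ≈ sumTerms (generator ∷ []) m
    unit-multiple m rewrite /ₘ-one m = ≈-sym (≈-trans (+-identityʳ _) (*-identityˡ _))

theorem1 : ∀ {c ℓ : Level} (K : Field c ℓ) (n r : ℕ)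
    (C : F2^ n → Set) (H : Mat n r) (d : ℕ) →
    IsLinearCode C → IsParityCheck C H → IsMinDistance C d →
    (_≺_ : Mono n → Mono n → Set) →
    IsTermOrder _≺_ → IsDegCompatible _≺_ → VarsIncreasing _≺_ →
    (G : List (Polynomials.Poly K n)) →
    Polynomials.IsReducedGroebnerBasis K n _≺_ (Polynomials.IdealOfCode K n C) G →
    (w u : Mono n) →
    -- Can(w, G) = u
    Polynomials.IsCanonicalForm K n _≺_ G (Polynomials.monoC K n w) (Polynomials.monoC K n u) →
    (weight (ψ u) ≤ capacity d → IsErrorVector C H (capacity d) (ψ w) (ψ u)) ×
    (weight (ψ u) > capacity d → ¬ InBall C (capacity d) (ψ w))
theorem1 K n r C H d _ parity _ _≺_ _ degCompatible _ G reduced w u canonical =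
  sameSyndrome⇒IsErrorVector parity {e = ψ u} sameSyndrome , tooManyErrors
  where
  open Polynomials.IsReducedGroebnerBasis reduced using (groebner)

  sameSyndrome : ψ u · H ≡ ψ w · H
  sameSyndrome = canonicalForm-sameSyndrome K parity groebner canonical

  tooManyErrors : weight (ψ u) > capacity d → ¬ InBall C (capacity d) (ψ w)
  tooManyErrors t<wt inBall with InBall⇒lightSameSyndrome parity inBall
  ... | e , wt≤t , eH≡wH = canonicalMonomial-notLeading K _≺_ groebner canonical
    (binomial∈IdealOfCode K parity (sameSyndrome⇒∈C parity uH≡vH))
    (binomial-IsLM K _≺_ (degCompatible v u deg<) λ v≡u → <-irrefl (cong deg v≡u) deg<)
    where
    v : Mono n
    v = squarefree e
    deg< : deg v < deg u
    deg< = begin-strict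
      deg v         ≡⟨ deg-squarefree e ⟩
      weight e      ≤⟨ wt≤t ⟩
      capacity d    <⟨ t<wt ⟩
      weight (ψ u)  ≤⟨ weight-ψ≤deg u ⟩
      deg u         ∎
      where open ℕ.≤-Reasoning
    uH≡vH : ψ u · H ≡ ψ v · H
    uH≡vH = trans sameSyndrome (trans (sym eH≡wH) (cong (_· H) (sym (ψ-squarefree e))))
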